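{- Let $H\in M_N(\mathbb C)$ and $K\in M_M(\mathbb C)$ be complex Hadamard matrices. If $B\in\widetilde{T}_HC_N$ and $C\in\widetilde{T}_KC_M$, then $B\otimes C=(B_{ij}C_{ab})_{ia,jb}\in\widetilde{T}_{H\otimes K}C_{NM}$, where $(H\otimes K)_{ia,jb}=H_{ij}K_{ab}$. Consequently $\widetilde{T}_HC_N\otimes\widetilde{T}_KC_M\subset\widetilde{T}_{H\otimes K}C_{NM}$.
   Context: A complex Hadamard matrix is a square complex matrix with all entries of modulus $1$ and pairwise orthogonal rows. For a complex Hadamard matrix $H\in M_N(\mathbb C)$, $\widetilde{T}_HC_N$ denotes the real vector space of all $A\in M_N(\mathbb R)$ with $\sum_k H_{ik}\bar{H}_{jk}(A_{ik}-A_{jk})=0$ for all $i,j$. -}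

module Defs where

open import Level using (_⊔_)
open import Algebra.Bundles using (CommutativeRing)
open import Data.Nat using (ℕ; zero; suc) renaming (_*_ to _*ℕ_)
open import Data.Fin using (Fin; zero; suc; remQuot)
open import Data.Product using (_×_; _,_; proj₁; proj₂)
open import Data.List using (List; []; _∷_)
open import Relation.Nullary using (¬_)
open import Relation.Binary.PropositionalEquality using (_≡_)

-- The real numbers are not available in agda-stdlib.  We work over an
-- arbitrary commutative ring R in the role of ℝ, and model ℂ as R × R
-- (x + i y) with the usual operations.
module ComplexOver {c ℓ} (R : CommutativeRing c ℓ) where
  open CommutativeRing R using (_≈_; _+_; _*_; -_; _-_; 0#; 1#) renaming (Carrier to ℝ)

  ℂ : Set c
  ℂ = ℝ × ℝ

  _≈ℂ_ : ℂ → ℂ → Set ℓ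
  (a , b) ≈ℂ (a' , b') = (a ≈ a') × (b ≈ b')

  _+ℂ_ : ℂ → ℂ → ℂ
  (a , b) +ℂ (a' , b') = (a + a') , (b + b')

  _*ℂ_ : ℂ → ℂ → ℂ
  (a , b) *ℂ (a' , b') = ((a * a') - (b * b')) , ((a * b') + (b * a'))

  0ℂ : ℂ
  0ℂ = 0# , 0#

  ofReal : ℝ → ℂ
  ofReal x = x , 0#

  conj : ℂ → ℂ
  conj (a , b) = a , (- b)

  normSq : ℂ → ℝ
  normSq (a , b) = (a * a) + (b * b)

  Σℂ : ∀ n → (Fin n → ℂ) → ℂ
  Σℂ zero    f = 0ℂ
  Σℂ (suc n) f = f zero +ℂ Σℂ n (λ k → f (suc k))

  CMat : ℕ → Set c
  CMat N = Fin N → Fin N → ℂ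

  RMat : ℕ → Set c
  RMat N = Fin N → Fin N → ℝ

  IsHadamard : ∀ {N} → CMat N → Set ℓ
  IsHadamard {N} H =
    (∀ i j → normSq (H i j) ≈ 1#) ×
    (∀ i j → ¬ (i ≡ j) → Σℂ N (λ k → H i k *ℂ conj (H j k)) ≈ℂ 0ℂ)

  InTangent : ∀ {N} → CMat N → RMat N → Set ℓ
  InTangent {N} H A = ∀ i j →
    Σℂ N (λ k → (H i k *ℂ conj (H j k)) *ℂ ofReal (A i k - A j k)) ≈ℂ 0ℂ

  -- Kronecker products; the index (i,a) of Fin N × Fin M corresponds to
  -- combine i a : Fin (N * M), decoded by remQuot M.
  kronC : ∀ {N M} → CMat N → CMat M → CMat (N *ℕ M)
  kronC {N} {M} H K p q with remQuot M p | remQuot M q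
  ... | i , a | j , b = H i j *ℂ K a b

  kronR : ∀ {N M} → RMat N → RMat M → RMat (N *ℕ M)
  kronR {N} {M} B C p q with remQuot M p | remQuot M q
  ... | i , a | j , b = B i j * C a b

  zeroR : ∀ {N} → RMat N
  zeroR i j = 0#

  linCombKron : ∀ {N M} → List (ℝ × RMat N × RMat M) → RMat (N *ℕ M)
  linCombKron []                    = zeroR
  linCombKron ((l , B , C) ∷ ts) p q = (l * kronR B C p q) + linCombKron ts p q

module Submission where

-- Write X_k = H_ik conj(H_jk), Y_c = K_ac conj(K_bc).  Entry (ia, jb) of the
-- tangent condition for B ⊗ C is the double sum
--   Σ_k Σ_c X_k Y_c (B_ik C_ac − B_jk C_bc),
-- and B_ik C_ac − B_jk C_bc = B_ik (C_ac − C_bc) + (B_ik − B_jk) C_bc splits it as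
--   (Σ_k X_k B_ik)(Σ_c Y_c (C_ac − C_bc)) + (Σ_k X_k (B_ik − B_jk))(Σ_c Y_c C_bc),
-- where the second and third factors are the tangent conditions of C and B, hence 0.
-- The tangent condition is linear in A, which gives the statement on linear
-- combinations.

open import Defs
open import Algebra.Bundles using (CommutativeRing; RawRing; AbelianGroup; Monoid; Semiring)
open import Data.Nat as ℕ using (ℕ; zero; suc)
open import Data.Product using (_×_; _,_; proj₁; proj₂)
open import Data.List using (List; []; _∷_)
open import Data.List.Relation.Unary.All using (All; []; _∷_)
open import Data.Fin using (Fin; zero; suc; _↑ˡ_; _↑ʳ_; combine; remQuot; quotient; remainder)
open import Data.Fin.Properties using (remQuot-combine)
open import Data.Maybe using (Maybe; just; nothing)
open import Level using (0ℓ)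
open import Relation.Binary.PropositionalEquality as ≡ using (_≡_)
open import Relation.Nullary using (yes; no)
open import Algebra.Solver.Ring.AlmostCommutativeRing using (fromCommutativeRing; _-Raw-AlmostCommutative⟶_)
import Algebra.Construct.DirectProduct as DirectProduct

-- The integers as formal differences (m , n) ~ m − n of natural numbers; the
-- solver compares such coefficients only after evaluation, so equality on the
-- representatives can stay syntactic.
ℕ-differences : RawRing 0ℓ 0ℓ
ℕ-differences = record
  { Carrier = ℕ × ℕ
  ; _≈_     = _≡_
  ; _+_     = λ { (m , n) (m' , n') → m ℕ.+ m' , n ℕ.+ n' }
  ; _*_     = λ { (m , n) (m' , n') → m ℕ.* m' ℕ.+ n ℕ.* n' , m ℕ.* n' ℕ.+ n ℕ.* m' }
  ; -_      = λ { (m , n) → n , m }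
  ; 0#      = 0 , 0
  ; 1#      = 1 , 0
  }

module IntegerRingSolver {c ℓ} (R : CommutativeRing c ℓ) where
  open CommutativeRing R
  open import Relation.Binary.Reasoning.Setoid setoid
  open import Algebra.Properties.Ring ring using (x[y-z]≈xy-xz; [y-z]x≈yx-zx)
  open import Algebra.Properties.AbelianGroup +-abelianGroup using (⁻¹-∙-comm; ⁻¹-anti-homo‿-)
  open import Algebra.Properties.Group +-group using (ε⁻¹≈ε)
  open import Algebra.Properties.CommutativeSemigroup +-commutativeSemigroup using (interchange)
  open import Algebra.Properties.Monoid.Mult.TCOptimised +-monoid using (×-homo-+) renaming (_×_ to _×′_)
  open import Algebra.Properties.Semiring.Mult.TCOptimised semiring using (×1-homo-*)

  ι : ℕ → Carrier
  ι n = n ×′ 1#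

  -‿interchange : ∀ a a' b b' → (a + a') - (b + b') ≈ (a - b) + (a' - b')
  -‿interchange a a' b b' = begin
    (a + a') + - (b + b')    ≈⟨ +-congˡ (⁻¹-∙-comm b b') ⟨
    (a + a') + (- b + - b')  ≈⟨ interchange a a' (- b) (- b') ⟩
    (a - b) + (a' - b')      ∎

  -‿cancelʳ : ∀ x y z → (x + z) - (y + z) ≈ x - y
  -‿cancelʳ x y z = begin
    (x + z) - (y + z)  ≈⟨ -‿interchange x z y z ⟩
    (x - y) + (z - z)  ≈⟨ +-congˡ (-‿inverseʳ z) ⟩
    (x - y) + 0#       ≈⟨ +-identityʳ _ ⟩
    x - y              ∎

  -‿cong-cross : ∀ {a b c d} → a + d ≈ c + b → a - b ≈ c - d
  -‿cong-cross {a} {b} {c} {d} eq = begin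
    a - b              ≈⟨ -‿cancelʳ a b d ⟨
    (a + d) - (b + d)  ≈⟨ +-cong eq (-‿cong (+-comm b d)) ⟩
    (c + b) - (d + b)  ≈⟨ -‿cancelʳ c d b ⟩
    c - d              ∎

  -‿*-expand : ∀ a b c d → (a * c + b * d) - (a * d + b * c) ≈ (a - b) * (c - d)
  -‿*-expand a b c d = sym (begin
    (a - b) * (c - d)                    ≈⟨ [y-z]x≈yx-zx (c - d) a b ⟩
    a * (c - d) - b * (c - d)            ≈⟨ +-cong (x[y-z]≈xy-xz a c d) (-‿cong (x[y-z]≈xy-xz b c d)) ⟩
    (a * c - a * d) - (b * c - b * d)    ≈⟨ +-congˡ (⁻¹-anti-homo‿- (b * c) (b * d)) ⟩
    (a * c - a * d) + (b * d - b * c)    ≈⟨ -‿interchange (a * c) (b * d) (a * d) (b * c) ⟨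
    (a * c + b * d) - (a * d + b * c)    ∎)

  -- evaluation of formal differences; chosen so that m − 0 evaluates to
  -- exactly m ×′ 1#, which makes the constants 0 and 1 evaluate to 0# and 1#
  [_] : ℕ × ℕ → Carrier
  [ m , zero ]  = ι m
  [ m , suc n ] = ι m - ι (suc n)

  []-diff : ∀ m n → [ m , n ] ≈ ι m - ι n
  []-diff m zero    = sym (trans (+-congˡ ε⁻¹≈ε) (+-identityʳ (ι m)))
  []-diff m (suc n) = refl

  ι-+ : ∀ m n → ι (m ℕ.+ n) ≈ ι m + ι n
  ι-+ = ×-homo-+ 1#

  homomorphism : ℕ-differences -Raw-AlmostCommutative⟶ fromCommutativeRing R
  homomorphism = record
    { ⟦_⟧    = [_]
    ; +-homo = λ { (m , n) (m' , n') → begin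
        [ m ℕ.+ m' , n ℕ.+ n' ]             ≈⟨ []-diff (m ℕ.+ m') (n ℕ.+ n') ⟩
        ι (m ℕ.+ m') - ι (n ℕ.+ n')          ≈⟨ +-cong (ι-+ m m') (-‿cong (ι-+ n n')) ⟩
        (ι m + ι m') - (ι n + ι n')          ≈⟨ -‿interchange _ _ _ _ ⟩
        (ι m - ι n) + (ι m' - ι n')          ≈⟨ +-cong ([]-diff m n) ([]-diff m' n') ⟨
        [ m , n ] + [ m' , n' ]              ∎ }
    ; *-homo = λ { (m , n) (m' , n') → begin
        [ m ℕ.* m' ℕ.+ n ℕ.* n' , m ℕ.* n' ℕ.+ n ℕ.* m' ]   ≈⟨ []-diff (m ℕ.* m' ℕ.+ n ℕ.* n') (m ℕ.* n' ℕ.+ n ℕ.* m') ⟩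
        ι (m ℕ.* m' ℕ.+ n ℕ.* n') - ι (m ℕ.* n' ℕ.+ n ℕ.* m')
          ≈⟨ +-cong (trans (ι-+ (m ℕ.* m') (n ℕ.* n')) (+-cong (×1-homo-* m m') (×1-homo-* n n')))
                    (-‿cong (trans (ι-+ (m ℕ.* n') (n ℕ.* m')) (+-cong (×1-homo-* m n') (×1-homo-* n m')))) ⟩
        (ι m * ι m' + ι n * ι n') - (ι m * ι n' + ι n * ι m')  ≈⟨ -‿*-expand _ _ _ _ ⟩
        (ι m - ι n) * (ι m' - ι n')                            ≈⟨ *-cong ([]-diff m n) ([]-diff m' n') ⟨
        [ m , n ] * [ m' , n' ]                                ∎ }
    ; -‿homo = λ { (m , n) → begin
        [ n , m ]        ≈⟨ []-diff n m ⟩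
        ι n - ι m        ≈⟨ ⁻¹-anti-homo‿- (ι m) (ι n) ⟨
        - (ι m - ι n)    ≈⟨ -‿cong ([]-diff m n) ⟨
        - [ m , n ]      ∎ }
    ; 0-homo = refl
    ; 1-homo = refl
    }

  coefficient≟ : ∀ x y → Maybe ([ x ] ≈ [ y ])
  coefficient≟ (m , n) (m' , n') with m ℕ.+ n' ℕ.≟ m' ℕ.+ n
  ... | no _  = nothing
  ... | yes e = just (begin
    [ m , n ]      ≈⟨ []-diff m n ⟩
    ι m - ι n      ≈⟨ -‿cong-cross (begin
                        ι m + ι n'       ≈⟨ ι-+ m n' ⟨
                        ι (m ℕ.+ n')     ≡⟨ ≡.cong ι e ⟩
                        ι (m' ℕ.+ n)     ≈⟨ ι-+ m' n ⟩
                        ι m' + ι n       ∎) ⟩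
    ι m' - ι n'    ≈⟨ []-diff m' n' ⟨
    [ m' , n' ]    ∎)

  open import Algebra.Solver.Ring ℕ-differences (fromCommutativeRing R) homomorphism coefficient≟ public
    using (Polynomial; solve; _:=_; con; _:+_; _:*_; _:-_; :-_)


module ComplexRing {c ℓ} (R : CommutativeRing c ℓ) where
  open CommutativeRing R
  open ComplexOver R
  open IntegerRingSolver R

  -ℂ_ : ℂ → ℂ
  -ℂ (a , b) = - a , - b

  1ℂ : ℂ
  1ℂ = 1# , 0#

  private
    Pℂ : ℕ → Set
    Pℂ n = Polynomial n × Polynomial n

    _⊗_ : ∀ {n} → Pℂ n → Pℂ n → Pℂ n
    (a , b) ⊗ (a' , b') = (a :* a' :- b :* b') , (a :* b' :+ b :* a')

    _⊕_ : ∀ {n} → Pℂ n → Pℂ n → Pℂ n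
    (a , b) ⊕ (a' , b') = (a :+ a') , (b :+ b')

    one : ∀ {n} → Pℂ n
    one = con (1 , 0) , con (0 , 0)

  -- the multiplicative laws, each checked by the solver on the real and the
  -- imaginary part (the additive group is the direct square of that of R)
  *ℂ-cong : ∀ {z z' w w'} → z ≈ℂ z' → w ≈ℂ w' → (z *ℂ w) ≈ℂ (z' *ℂ w')
  *ℂ-cong (p , q) (p' , q') = +-cong (*-cong p p') (-‿cong (*-cong q q')) , +-cong (*-cong p q') (*-cong q p')

  *ℂ-assoc : ∀ z w u → ((z *ℂ w) *ℂ u) ≈ℂ (z *ℂ (w *ℂ u))
  *ℂ-assoc (a , b) (a' , b') (a'' , b'') =
    solve 6 (λ a b a' b' a'' b'' → let z = (a , b) ; w = (a' , b') ; u = (a'' , b'') in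
               proj₁ ((z ⊗ w) ⊗ u) := proj₁ (z ⊗ (w ⊗ u))) refl a b a' b' a'' b'' ,
    solve 6 (λ a b a' b' a'' b'' → let z = (a , b) ; w = (a' , b') ; u = (a'' , b'') in
               proj₂ ((z ⊗ w) ⊗ u) := proj₂ (z ⊗ (w ⊗ u))) refl a b a' b' a'' b''

  *ℂ-comm : ∀ z w → (z *ℂ w) ≈ℂ (w *ℂ z)
  *ℂ-comm (a , b) (a' , b') =
    solve 4 (λ a b a' b' → let z = (a , b) ; w = (a' , b') in
               proj₁ (z ⊗ w) := proj₁ (w ⊗ z)) refl a b a' b' ,
    solve 4 (λ a b a' b' → let z = (a , b) ; w = (a' , b') in
               proj₂ (z ⊗ w) := proj₂ (w ⊗ z)) refl a b a' b'

  *ℂ-identityˡ : ∀ z → (1ℂ *ℂ z) ≈ℂ z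
  *ℂ-identityˡ (a , b) =
    solve 2 (λ a b → proj₁ (one ⊗ (a , b)) := a) refl a b ,
    solve 2 (λ a b → proj₂ (one ⊗ (a , b)) := b) refl a b

  *ℂ-identityʳ : ∀ z → (z *ℂ 1ℂ) ≈ℂ z
  *ℂ-identityʳ (a , b) =
    solve 2 (λ a b → proj₁ ((a , b) ⊗ one) := a) refl a b ,
    solve 2 (λ a b → proj₂ ((a , b) ⊗ one) := b) refl a b

  *ℂ-distribˡ : ∀ z w u → (z *ℂ (w +ℂ u)) ≈ℂ ((z *ℂ w) +ℂ (z *ℂ u))
  *ℂ-distribˡ (a , b) (a' , b') (a'' , b'') =
    solve 6 (λ a b a' b' a'' b'' → let z = (a , b) ; w = (a' , b') ; u = (a'' , b'') in
               proj₁ (z ⊗ (w ⊕ u)) := proj₁ ((z ⊗ w) ⊕ (z ⊗ u))) refl a b a' b' a'' b'' ,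
    solve 6 (λ a b a' b' a'' b'' → let z = (a , b) ; w = (a' , b') ; u = (a'' , b'') in
               proj₂ (z ⊗ (w ⊕ u)) := proj₂ ((z ⊗ w) ⊕ (z ⊗ u))) refl a b a' b' a'' b''

  *ℂ-distribʳ : ∀ z w u → ((w +ℂ u) *ℂ z) ≈ℂ ((w *ℂ z) +ℂ (u *ℂ z))
  *ℂ-distribʳ (a , b) (a' , b') (a'' , b'') =
    solve 6 (λ a b a' b' a'' b'' → let z = (a , b) ; w = (a' , b') ; u = (a'' , b'') in
               proj₁ ((w ⊕ u) ⊗ z) := proj₁ ((w ⊗ z) ⊕ (u ⊗ z))) refl a b a' b' a'' b'' ,
    solve 6 (λ a b a' b' a'' b'' → let z = (a , b) ; w = (a' , b') ; u = (a'' , b'') in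
               proj₂ ((w ⊕ u) ⊗ z) := proj₂ ((w ⊗ z) ⊕ (u ⊗ z))) refl a b a' b' a'' b''

  -- its operations are literally those of Defs, so ring lemmas apply to them directly
  ℂ-commutativeRing : CommutativeRing c ℓ
  ℂ-commutativeRing = record
    { Carrier = ℂ
    ; _≈_     = _≈ℂ_
    ; _+_     = _+ℂ_
    ; _*_     = _*ℂ_
    ; -_      = -ℂ_
    ; 0#      = 0ℂ
    ; 1#      = 1ℂ
    ; isCommutativeRing = record
      { isRing = record
        { +-isAbelianGroup = AbelianGroup.isAbelianGroup
                               (DirectProduct.abelianGroup +-abelianGroup +-abelianGroup)
        ; *-cong     = *ℂ-cong
        ; *-assoc    = *ℂ-assoc
        ; *-identity = *ℂ-identityˡ , *ℂ-identityʳ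
        ; distrib    = *ℂ-distribˡ , *ℂ-distribʳ
        }
      ; *-comm = *ℂ-comm
      }
    }

  ofReal-cong : ∀ {x y} → x ≈ y → ofReal x ≈ℂ ofReal y
  ofReal-cong x≈y = x≈y , refl

  ofReal-+ : ∀ x y → ofReal (x + y) ≈ℂ (ofReal x +ℂ ofReal y)
  ofReal-+ x y = refl , sym (+-identityʳ 0#)

  ofReal-* : ∀ x y → ofReal (x * y) ≈ℂ (ofReal x *ℂ ofReal y)
  ofReal-* x y =
    solve 2 (λ x y → x :* y := x :* y :- con (0 , 0) :* con (0 , 0)) refl x y ,
    solve 2 (λ x y → con (0 , 0) := x :* con (0 , 0) :+ con (0 , 0) :* y) refl x y

  conj-* : ∀ z w → conj (z *ℂ w) ≈ℂ (conj z *ℂ conj w)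
  conj-* (a , b) (a' , b') =
    solve 4 (λ a b a' b' → a :* a' :- b :* b' := a :* a' :- (:- b) :* (:- b')) refl a b a' b' ,
    solve 4 (λ a b a' b' → :- (a :* b' :+ b :* a') := a :* (:- b') :+ (:- b) :* a') refl a b a' b'

module ProductSums {a ℓ} (M : Monoid a ℓ) where
  open Monoid M
  open import Algebra.Properties.Monoid.Sum M using (sum; sum-cong-≗)
  open import Relation.Binary.Reasoning.Setoid setoid

  sum-↑ : ∀ m n (f : Fin (m ℕ.+ n) → Carrier) →
          sum f ≈ sum (λ i → f (i ↑ˡ n)) ∙ sum (λ j → f (m ↑ʳ j))
  sum-↑ zero    n f = sym (identityˡ (sum f))
  sum-↑ (suc m) n f = begin
    f zero ∙ sum (λ k → f (suc k))                                    ≈⟨ ∙-congˡ (sum-↑ m n (λ k → f (suc k))) ⟩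
    f zero ∙ (sum (λ i → f (suc (i ↑ˡ n))) ∙ sum (λ j → f (suc m ↑ʳ j)))  ≈⟨ assoc _ _ _ ⟨
    (f zero ∙ sum (λ i → f (suc (i ↑ˡ n)))) ∙ sum (λ j → f (suc m ↑ʳ j))  ∎

  sum-combine : ∀ m n (f : Fin (m ℕ.* n) → Carrier) →
                sum f ≈ sum (λ (i : Fin m) → sum (λ (j : Fin n) → f (combine i j)))
  sum-combine zero    n f = refl
  sum-combine (suc m) n f = trans (sum-↑ n (m ℕ.* n) f)
                                  (∙-congˡ (sum-combine m n (λ r → f (n ↑ʳ r))))

  sum-remQuot : ∀ m n (F : Fin m × Fin n → Carrier) →
                sum (λ r → F (remQuot {m} n r)) ≈ sum (λ i → sum (λ j → F (i , j)))
  sum-remQuot m n F = trans (sum-combine m n (λ r → F (remQuot {m} n r)))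
    (reflexive (sum-cong-≗ (λ i → sum-cong-≗ (λ j → ≡.cong F (remQuot-combine i j)))))

module SemiringSums {a ℓ} (S : Semiring a ℓ) where
  open Semiring S
  open import Algebra.Properties.Semiring.Sum S using (sum; sum-cong-≋; ∑-distrib-+; *-distribˡ-sum; *-distribʳ-sum)
  open import Relation.Binary.Reasoning.Setoid setoid

  sum-product : ∀ {m n} (u : Fin m → Carrier) (v : Fin n → Carrier) →
                sum (λ i → sum (λ j → u i * v j)) ≈ sum u * sum v
  sum-product u v = sym (trans (*-distribʳ-sum (sum v) u)
                               (sum-cong-≋ (λ i → *-distribˡ-sum (u i) v)))

  double-sum-vanishes : ∀ {m n} (u u' : Fin m → Carrier) (v v' : Fin n → Carrier) →
    sum v ≈ 0# → sum u' ≈ 0# → sum (λ i → sum (λ j → u i * v j + u' i * v' j)) ≈ 0#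
  double-sum-vanishes u u' v v' Σv≈0 Σu'≈0 = begin
    sum (λ i → sum (λ j → u i * v j + u' i * v' j))
      ≈⟨ sum-cong-≋ (λ i → ∑-distrib-+ (λ j → u i * v j) (λ j → u' i * v' j)) ⟩
    sum (λ i → sum (λ j → u i * v j) + sum (λ j → u' i * v' j))
      ≈⟨ ∑-distrib-+ (λ i → sum (λ j → u i * v j)) (λ i → sum (λ j → u' i * v' j)) ⟩
    sum (λ i → sum (λ j → u i * v j)) + sum (λ i → sum (λ j → u' i * v' j))
      ≈⟨ +-cong (sum-product u v) (sum-product u' v') ⟩
    sum u * sum v + sum u' * sum v'
      ≈⟨ +-cong (*-congˡ Σv≈0) (*-congʳ Σu'≈0) ⟩
    sum u * 0# + 0# * sum v'
      ≈⟨ +-cong (zeroʳ (sum u)) (zeroˡ (sum v')) ⟩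
    0# + 0#
      ≈⟨ +-identityˡ 0# ⟩
    0# ∎

module TangentSpaces {c ℓ} (R : CommutativeRing c ℓ) where
  open ComplexOver R
  open ComplexRing R
  private module ℝ = CommutativeRing R
  open CommutativeRing ℂ-commutativeRing
  open import Relation.Binary.Reasoning.Setoid setoid
  open import Algebra.Properties.CommutativeSemigroup *-commutativeSemigroup using (interchange)
  open import Algebra.Properties.Semiring.Sum semiring using (sum; sum-cong-≋; sum-cong-≗; ∑-distrib-+; *-distribˡ-sum; sum-replicate-zero)
  open ProductSums +-monoid using (sum-remQuot)
  open SemiringSums semiring using (double-sum-vanishes)
  module ℝSolver = IntegerRingSolver R
  module ℂSolver = IntegerRingSolver ℂ-commutativeRing

  Σℂ≈sum : ∀ n (f : Fin n → ℂ) → Σℂ n f ≈ sum f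
  Σℂ≈sum zero    f = refl
  Σℂ≈sum (suc n) f = +-congˡ (Σℂ≈sum n (λ k → f (suc k)))

  -- the k-th summand of the tangent condition for rows h, h' and entries x, x';
  -- InTangent H A unfolds to ∀ i j → Σℂ N (λ k → summand (H i k) (H j k) (A i k) (A j k)) ≈ 0ℂ
  summand : ℂ → ℂ → ℝ.Carrier → ℝ.Carrier → ℂ
  summand h h' x x' = (h * conj h') * ofReal (x ℝ.- x')

  -- a summand of the Kronecker product splits into products of summands of the factors:
  -- b g − b' g' = b (g − g') + (b − b') g'
  kron-summand-split : ∀ h k h' k' b g b' g' →
    summand (h * k) (h' * k') (b ℝ.* g) (b' ℝ.* g') ≈
    ((h * conj h') * ofReal b) * summand k k' g g' + summand h h' b b' * ((k * conj k') * ofReal g')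
  kron-summand-split h k h' k' b g b' g' = begin
    ((h * k) * conj (h' * k')) * ofReal (b ℝ.* g ℝ.- b' ℝ.* g')
      ≈⟨ *-cong (trans (*-congˡ (conj-* h' k')) (interchange h k (conj h') (conj k'))) (ofReal-cong bilinear) ⟩
    (X * Y) * ofReal (b ℝ.* (g ℝ.- g') ℝ.+ (b ℝ.- b') ℝ.* g')
      ≈⟨ *-congˡ (trans (ofReal-+ _ _) (+-cong (ofReal-* b _) (ofReal-* _ g'))) ⟩
    (X * Y) * (ofReal b * ofReal (g ℝ.- g') + ofReal (b ℝ.- b') * ofReal g')
      ≈⟨ regroup X Y (ofReal b) (ofReal (g ℝ.- g')) (ofReal (b ℝ.- b')) (ofReal g') ⟩
    (X * ofReal b) * (Y * ofReal (g ℝ.- g')) + (X * ofReal (b ℝ.- b')) * (Y * ofReal g') ∎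
    where
    X = h * conj h'
    Y = k * conj k'
    bilinear : b ℝ.* g ℝ.- b' ℝ.* g' ℝ.≈ b ℝ.* (g ℝ.- g') ℝ.+ (b ℝ.- b') ℝ.* g'
    bilinear = ℝSolver.solve 4 (λ b g b' g' → b :* g :- b' :* g' := b :* (g :- g') :+ (b :- b') :* g')
                 ℝ.refl b g b' g'
      where open ℝSolver
    regroup : ∀ x y β γ δ ε → (x * y) * (β * γ + δ * ε) ≈ (x * β) * (y * γ) + (x * δ) * (y * ε)
    regroup = ℂSolver.solve 6 (λ x y β γ δ ε → (x :* y) :* (β :* γ :+ δ :* ε)
                                             := (x :* β) :* (y :* γ) :+ (x :* δ) :* (y :* ε)) refl
      where open ℂSolver

  kronC-entry : ∀ {N M} (H : CMat N) (K : CMat M) p q →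
    kronC H K p q ≡ H (quotient M p) (quotient M q) * K (remainder {N} M p) (remainder {N} M q)
  kronC-entry {N} {M} H K p q with remQuot {N} M p | remQuot {N} M q
  ... | _ | _ = ≡.refl

  kronR-entry : ∀ {N M} (B : RMat N) (C : RMat M) p q →
    kronR B C p q ≡ B (quotient M p) (quotient M q) ℝ.* C (remainder {N} M p) (remainder {N} M q)
  kronR-entry {N} {M} B C p q with remQuot {N} M p | remQuot {N} M q
  ... | _ | _ = ≡.refl

  kron-tangent : ∀ {N M} {H : CMat N} {K : CMat M} {B : RMat N} {C : RMat M} →
    InTangent H B → InTangent K C → InTangent (kronC H K) (kronR B C)
  kron-tangent {N} {M} {H} {K} {B} {C} hB hC p q = begin
    Σℂ (N ℕ.* M) (λ r → summand (kronC H K p r) (kronC H K q r) (kronR B C p r) (kronR B C q r))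
      ≈⟨ Σℂ≈sum (N ℕ.* M) _ ⟩
    sum (λ r → summand (kronC H K p r) (kronC H K q r) (kronR B C p r) (kronR B C q r))
      ≡⟨ sum-cong-≗ decode ⟩
    sum (λ r → F (remQuot M r))
      ≈⟨ sum-remQuot N M F ⟩
    sum (λ k → sum (λ c → F (k , c)))
      ≈⟨ sum-cong-≋ (λ k → sum-cong-≋ (λ c → kron-summand-split (H i k) (K a c) (H j k) (K b c)
                                                              (B i k) (C a c) (B j k) (C b c))) ⟩
    sum (λ k → sum (λ c → u k * v c + u' k * v' c))
      ≈⟨ double-sum-vanishes u u' v v' (trans (sym (Σℂ≈sum M v)) (hC a b))
                                       (trans (sym (Σℂ≈sum N u')) (hB i j)) ⟩
    0ℂ ∎
    where
    i = quotient M p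
    j = quotient M q
    a = remainder {N} M p
    b = remainder {N} M q
    F : Fin N × Fin M → ℂ
    F (k , c) = summand (H i k * K a c) (H j k * K b c) (B i k ℝ.* C a c) (B j k ℝ.* C b c)
    decode : ∀ r → summand (kronC H K p r) (kronC H K q r) (kronR B C p r) (kronR B C q r) ≡ F (remQuot M r)
    decode r rewrite kronC-entry H K p r | kronC-entry H K q r | kronR-entry B C p r | kronR-entry B C q r = ≡.refl
    u u' : Fin N → ℂ
    u k  = (H i k * conj (H j k)) * ofReal (B i k)
    u' k = summand (H i k) (H j k) (B i k) (B j k)
    v v' : Fin M → ℂ
    v c  = summand (K a c) (K b c) (C a c) (C b c)
    v' c = (K a c * conj (K b c)) * ofReal (C b c)

  summand-linear : ∀ h h' l x x' y y' →
    summand h h' (l ℝ.* x ℝ.+ y) (l ℝ.* x' ℝ.+ y') ≈ ofReal l * summand h h' x x' + summand h h' y y'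
  summand-linear h h' l x x' y y' = begin
    X * ofReal ((l ℝ.* x ℝ.+ y) ℝ.- (l ℝ.* x' ℝ.+ y'))
      ≈⟨ *-congˡ (ofReal-cong linear) ⟩
    X * ofReal (l ℝ.* (x ℝ.- x') ℝ.+ (y ℝ.- y'))
      ≈⟨ *-congˡ (trans (ofReal-+ _ _) (+-congʳ (ofReal-* l _))) ⟩
    X * (ofReal l * ofReal (x ℝ.- x') + ofReal (y ℝ.- y'))
      ≈⟨ regroup X (ofReal l) (ofReal (x ℝ.- x')) (ofReal (y ℝ.- y')) ⟩
    ofReal l * (X * ofReal (x ℝ.- x')) + X * ofReal (y ℝ.- y') ∎
    where
    X = h * conj h'
    linear : (l ℝ.* x ℝ.+ y) ℝ.- (l ℝ.* x' ℝ.+ y') ℝ.≈ l ℝ.* (x ℝ.- x') ℝ.+ (y ℝ.- y')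
    linear = ℝSolver.solve 5 (λ l x x' y y' → (l :* x :+ y) :- (l :* x' :+ y') := l :* (x :- x') :+ (y :- y'))
               ℝ.refl l x x' y y'
      where open ℝSolver
    regroup : ∀ x λ' δ δ' → x * (λ' * δ + δ') ≈ λ' * (x * δ) + x * δ'
    regroup = ℂSolver.solve 4 (λ x λ' δ δ' → x :* (λ' :* δ :+ δ') := λ' :* (x :* δ) :+ x :* δ') refl
      where open ℂSolver

  tangent-zero : ∀ {N} (H : CMat N) → InTangent H zeroR
  tangent-zero {N} H i j = begin
    Σℂ N (λ k → summand (H i k) (H j k) ℝ.0# ℝ.0#)  ≈⟨ Σℂ≈sum N _ ⟩
    sum (λ k → summand (H i k) (H j k) ℝ.0# ℝ.0#)   ≈⟨ sum-cong-≋ (λ k → summand-zero (H i k) (H j k)) ⟩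
    sum (λ (_ : Fin N) → 0ℂ)                         ≈⟨ sum-replicate-zero N ⟩
    0ℂ                                               ∎
    where
    summand-zero : ∀ h h' → summand h h' ℝ.0# ℝ.0# ≈ 0ℂ
    summand-zero h h' = trans (*-congˡ (ofReal-cong (ℝ.-‿inverseʳ ℝ.0#))) (zeroʳ _)

  tangent-combination : ∀ {N} {H : CMat N} {A A' : RMat N} l → InTangent H A → InTangent H A' →
    InTangent H (λ p q → l ℝ.* A p q ℝ.+ A' p q)
  tangent-combination {N} {H} {A} {A'} l hA hA' i j = begin
    Σℂ N (λ k → summand (H i k) (H j k) (l ℝ.* A i k ℝ.+ A' i k) (l ℝ.* A j k ℝ.+ A' j k))
      ≈⟨ Σℂ≈sum N _ ⟩
    sum (λ k → summand (H i k) (H j k) (l ℝ.* A i k ℝ.+ A' i k) (l ℝ.* A j k ℝ.+ A' j k))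
      ≈⟨ sum-cong-≋ (λ k → summand-linear (H i k) (H j k) l (A i k) (A j k) (A' i k) (A' j k)) ⟩
    sum (λ k → ofReal l * s k + s' k)
      ≈⟨ ∑-distrib-+ (λ k → ofReal l * s k) s' ⟩
    sum (λ k → ofReal l * s k) + sum s'
      ≈⟨ +-congʳ (*-distribˡ-sum (ofReal l) s) ⟨
    ofReal l * sum s + sum s'
      ≈⟨ +-cong (*-congˡ (trans (sym (Σℂ≈sum N s)) (hA i j))) (trans (sym (Σℂ≈sum N s')) (hA' i j)) ⟩
    ofReal l * 0ℂ + 0ℂ
      ≈⟨ trans (+-identityʳ _) (zeroʳ _) ⟩
    0ℂ ∎
    where
    s s' : Fin N → ℂ
    s k  = summand (H i k) (H j k) (A i k) (A j k)
    s' k = summand (H i k) (H j k) (A' i k) (A' j k)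

  kron-combination-tangent : ∀ {N M} {H : CMat N} {K : CMat M} (ts : List (ℝ.Carrier × RMat N × RMat M)) →
    All (λ t → InTangent H (proj₁ (proj₂ t)) × InTangent K (proj₂ (proj₂ t))) ts →
    InTangent (kronC H K) (linCombKron ts)
  kron-combination-tangent {H = H} {K} []                  []              = tangent-zero (kronC H K)
  kron-combination-tangent         ((l , B , C) ∷ ts) ((hB , hC) ∷ hs) =
    tangent-combination l (kron-tangent hB hC) (kron-combination-tangent ts hs)

proposition2p4 : ∀ {c ℓ} (R : CommutativeRing c ℓ) →
    let open ComplexOver R in
    ∀ {N M : ℕ} (H : CMat N) (K : CMat M) → IsHadamard H → IsHadamard K →
      (∀ (B : RMat N) (C : RMat M) → InTangent H B → InTangent K C →
        InTangent (kronC H K) (kronR B C))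
      ×
      (∀ (ts : List (CommutativeRing.Carrier R × RMat N × RMat M)) →
        All (λ { (l , B , C) → InTangent H B × InTangent K C }) ts →
        InTangent (kronC H K) (linCombKron ts))
proposition2p4 R H K _ _ =
  (λ B C → kron-tangent) , kron-combination-tangent
  where open TangentSpaces R
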